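{- Let $n\geq 1$ and let $G$ be any graph in $XQ_n$. Let $\{u_1,u_2,\ldots,u_k\}$ be a set of $k$ distinct nodes of $G$ with $k\leq n$. Then there exist distinct nodes $v_1,v_2,\ldots,v_k$ in $V(G)-\{u_1,u_2,\ldots,u_k\}$ such that $\{u_i,v_i\}\in E(G)$ for every $1\leq i\leq k$.
   Context: Hypercube-like graphs: $XQ_1=\{K_2\}$, where $K_2$ is the complete graph on two nodes. For $n\geq 1$, if $G_0=(V_0,E_0)$ and $G_1=(V_1,E_1)$ are graphs in $XQ_n$ on disjoint node sets and $\phi:V_0\to V_1$ is any bijection, then the graph $G_0\oplus G_1$ with node set $V_0\cup V_1$ and edge set $E_0\cup E_1\cup\{\{v,\phi(v)\}\mid v\in V_0\}$ belongs to $XQ_{n+1}$; $XQ_{n+1}$ consists exactly of the graphs obtained in this way (for all choices of $G_0,G_1,\phi$). Every graph in $XQ_n$ is a simple $n$-regular graph on $2^n$ nodes. -}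

module Defs where

open import Data.Nat using (ℕ; zero) renaming (suc to sucℕ)
open import Data.Bool using (Bool; true; false)
open import Data.Sum using (_⊎_; inj₁; inj₂)
open import Data.Empty using (⊥)
open import Data.Unit using (⊤)
open import Relation.Binary.PropositionalEquality using (_≡_)
open import Function.Bundles using (_⤖_; Bijection)

-- A (simple, undirected) graph on node type V is given by its edge relation
-- Adj u v meaning {u,v} ∈ E.  Graphs are taken up to this representation;
-- node sets of G0 and G1 are made disjoint via the disjoint union ⊎.

K₂ : Bool → Bool → Set
K₂ true  false = ⊤
K₂ false true  = ⊤
K₂ _     _     = ⊥

_⊕[_]_ : {V₀ V₁ : Set} → (V₀ → V₀ → Set) → (V₀ ⤖ V₁) → (V₁ → V₁ → Set)
       → (V₀ ⊎ V₁ → V₀ ⊎ V₁ → Set)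
(E₀ ⊕[ φ ] E₁) (inj₁ a) (inj₁ b) = E₀ a b
(E₀ ⊕[ φ ] E₁) (inj₂ a) (inj₂ b) = E₁ a b
(E₀ ⊕[ φ ] E₁) (inj₁ a) (inj₂ b) = Bijection.to φ a ≡ b
(E₀ ⊕[ φ ] E₁) (inj₂ a) (inj₁ b) = Bijection.to φ b ≡ a

record _≅G_ {V W : Set} (E : V → V → Set) (F : W → W → Set) : Set where
  field
    iso      : V ⤖ W
    preserve : ∀ {a b} → E a b → F (Bijection.to iso a) (Bijection.to iso b)
    reflect  : ∀ {a b} → F (Bijection.to iso a) (Bijection.to iso b) → E a b

-- Hypercube-like graphs XQ n.  Since node sets are arbitrary sets, membership
-- is closed under renaming of nodes (graph isomorphism).
data XQ : ℕ → (V : Set) → (V → V → Set) → Set₁ where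
  base : XQ 1 Bool K₂
  sum  : ∀ {n V₀ V₁ E₀ E₁} → XQ n V₀ E₀ → XQ n V₁ E₁ → (φ : V₀ ⤖ V₁)
       → XQ (sucℕ n) (V₀ ⊎ V₁) (E₀ ⊕[ φ ] E₁)
  rename : ∀ {n V W E F} → XQ n V E → E ≅G F → XQ n W F

-- Prove the claim for an arbitrary node list S with |S| ≤ n, by induction on
-- the construction of G.  In K₂ each node is matched to the other one.  In
-- G₀ ⊕ G₁ either S lies on one side, and then φ matches it into the other
-- side, or both sides of S are nonempty, hence each has at most n nodes and
-- the matchings given by induction in G₀ and G₁ combine.
{-# OPTIONS --safe #-}
module Submission where

open import Defs
open import Data.Nat using (ℕ; _≤_; _<_; _≥_; suc; s≤s; s≤s⁻¹; z<s; _+_)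
open import Data.Nat.Properties using (<-≤-trans; m<m+n; m<n+m; +-suc)
open import Data.Fin using (Fin)
open import Data.Product using (Σ; _×_; _,_)
open import Data.Sum using (_⊎_; inj₁; inj₂)
open import Data.Sum.Properties using (inj₁-injective; inj₂-injective)
open import Data.Bool using (true; false; not)
open import Data.Bool.Properties using (not-injective; not-¬)
open import Data.Unit using (tt)
open import Data.Empty using (⊥)
open import Data.List using (List; []; _∷_; length; map; tabulate)
open import Data.List.Relation.Unary.Any using (here; there)
open import Data.List.Relation.Unary.Any.Properties using (¬Any[])
open import Data.List.Membership.Propositional using (_∈_)
open import Data.List.Membership.Propositional.Properties using (∈-map⁺; ∈-tabulate⁺)
open import Data.List.Properties using (length-map; length-tabulate)
open import Relation.Binary.PropositionalEquality
  using (_≡_; _≢_; refl; sym; trans; cong; subst; module ≡-Reasoning)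
open import Relation.Nullary using (¬_)
open import Function.Definitions using (Injective)
open import Function.Bundles using (_⤖_; Bijection; Inverse)
open import Function.Properties.Bijection using (⤖⇒↔)

record OutMatching {V : Set} (E : V → V → Set) (S : List V) : Set where
  field
    partner     : V → V
    adjacent    : ∀ {x} → x ∈ S → E x (partner x)
    avoids      : ∀ {x y} → x ∈ S → y ∈ S → partner x ≢ y
    injectiveOn : ∀ {x y} → x ∈ S → y ∈ S → partner x ≡ partner y → x ≡ y

module _ {A B : Set} where

  lefts : List (A ⊎ B) → List A
  lefts []             = []
  lefts (inj₁ a ∷ xs) = a ∷ lefts xs
  lefts (inj₂ _ ∷ xs) = lefts xs

  rights : List (A ⊎ B) → List B
  rights []             = []
  rights (inj₁ _ ∷ xs) = rights xs
  rights (inj₂ b ∷ xs) = b ∷ rights xs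

  ∈-lefts⁺ : ∀ {a} xs → inj₁ a ∈ xs → a ∈ lefts xs
  ∈-lefts⁺ (inj₁ _ ∷ xs) (here refl) = here refl
  ∈-lefts⁺ (inj₁ _ ∷ xs) (there p)   = there (∈-lefts⁺ xs p)
  ∈-lefts⁺ (inj₂ _ ∷ xs) (there p)   = ∈-lefts⁺ xs p

  ∈-rights⁺ : ∀ {b} xs → inj₂ b ∈ xs → b ∈ rights xs
  ∈-rights⁺ (inj₂ _ ∷ xs) (here refl) = here refl
  ∈-rights⁺ (inj₂ _ ∷ xs) (there p)   = there (∈-rights⁺ xs p)
  ∈-rights⁺ (inj₁ _ ∷ xs) (there p)   = ∈-rights⁺ xs p

  length-lefts+rights : ∀ xs → length (lefts xs) + length (rights xs) ≡ length xs
  length-lefts+rights []             = refl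
  length-lefts+rights (inj₁ _ ∷ xs) = cong suc (length-lefts+rights xs)
  length-lefts+rights (inj₂ _ ∷ xs) =
    trans (+-suc (length (lefts xs)) _) (cong suc (length-lefts+rights xs))

  OneSided : List (A ⊎ B) → Set
  OneSided xs = ∀ {a b} → inj₁ a ∈ xs → inj₂ b ∈ xs → ⊥

  oneSided-or-sidesShorter : ∀ xs → OneSided xs
    ⊎ (length (lefts xs) < length xs × length (rights xs) < length xs)
  oneSided-or-sidesShorter xs
    with lefts xs in eqL | rights xs in eqR | length-lefts+rights xs
  ... | [] | _ | _ = inj₁ λ a∈ _ → ¬Any[] (subst (_ ∈_) eqL (∈-lefts⁺ xs a∈))
  ... | _ ∷ _ | [] | _ = inj₁ λ _ b∈ → ¬Any[] (subst (_ ∈_) eqR (∈-rights⁺ xs b∈))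
  ... | ls@(_ ∷ _) | rs@(_ ∷ _) | |L|+|R|≡|S| = inj₂
    ( subst (length ls <_) |L|+|R|≡|S| (m<m+n (length ls) z<s)
    , subst (length rs <_) |L|+|R|≡|S| (m<n+m (length rs) z<s) )

K₂-not : ∀ x → K₂ x (not x)
K₂-not true  = tt
K₂-not false = tt

≤1-∈-unique : {A : Set} {S : List A} → length S ≤ 1 → ∀ {x y} → x ∈ S → y ∈ S → x ≡ y
≤1-∈-unique {S = _ ∷ []}    _ (here refl) (here refl) = refl
≤1-∈-unique {S = _ ∷ _ ∷ _} (s≤s ())

K₂-outMatching : ∀ {S} → length S ≤ 1 → OutMatching K₂ S
K₂-outMatching |S|≤1 = record
  { partner     = not
  ; adjacent    = λ {x} _ → K₂-not x
  ; avoids      = λ x∈ y∈ e → not-¬ (≤1-∈-unique |S|≤1 y∈ x∈) (sym e)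
  ; injectiveOn = λ _ _ → not-injective
  }

module _ {A B : Set} (φ : A ⤖ B) where
  open Inverse (⤖⇒↔ φ) using (to; from; strictlyInverseˡ)

  from-injective : Injective _≡_ _≡_ from
  from-injective {a} {b} e = begin
    a             ≡⟨ strictlyInverseˡ a ⟨
    to (from a)   ≡⟨ cong to e ⟩
    to (from b)   ≡⟨ strictlyInverseˡ b ⟩
    b             ∎
    where open ≡-Reasoning

module _ {V₀ V₁ : Set} {E₀ : V₀ → V₀ → Set} {E₁ : V₁ → V₁ → Set} (φ : V₀ ⤖ V₁) where
  open Bijection φ using (to; injective)
  open Inverse (⤖⇒↔ φ) using (from; strictlyInverseˡ)

  across : V₀ ⊎ V₁ → V₀ ⊎ V₁
  across (inj₁ a) = inj₂ (to a)
  across (inj₂ b) = inj₁ (from b)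

  across-injective : Injective _≡_ _≡_ across
  across-injective {inj₁ _} {inj₁ _} e = cong inj₁ (injective (inj₂-injective e))
  across-injective {inj₂ _} {inj₂ _} e = cong inj₂ (from-injective φ (inj₁-injective e))

  across-outMatching : ∀ {S} → OneSided S → OutMatching (E₀ ⊕[ φ ] E₁) S
  across-outMatching {S} oneSided = record
    { partner     = across
    ; adjacent    = adjacent
    ; avoids      = avoids
    ; injectiveOn = λ _ _ → across-injective
    }
    where
    adjacent : ∀ {x} → x ∈ S → (E₀ ⊕[ φ ] E₁) x (across x)
    adjacent {inj₁ _} _ = refl
    adjacent {inj₂ b} _ = strictlyInverseˡ b
    avoids : ∀ {x y} → x ∈ S → y ∈ S → across x ≢ y
    avoids {inj₁ _} x∈ y∈ refl = oneSided x∈ y∈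
    avoids {inj₂ _} x∈ y∈ refl = oneSided y∈ x∈

  ⊕-outMatching : ∀ {S} → OutMatching E₀ (lefts S) → OutMatching E₁ (rights S)
    → OutMatching (E₀ ⊕[ φ ] E₁) S
  ⊕-outMatching {S} M₀ M₁ = record
    { partner     = partner
    ; adjacent    = adjacent
    ; avoids      = avoids
    ; injectiveOn = injectiveOn
    }
    where
    module M₀ = OutMatching M₀
    module M₁ = OutMatching M₁
    partner : V₀ ⊎ V₁ → V₀ ⊎ V₁
    partner (inj₁ a) = inj₁ (M₀.partner a)
    partner (inj₂ b) = inj₂ (M₁.partner b)
    adjacent : ∀ {x} → x ∈ S → (E₀ ⊕[ φ ] E₁) x (partner x)
    adjacent {inj₁ _} x∈ = M₀.adjacent (∈-lefts⁺ S x∈)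
    adjacent {inj₂ _} x∈ = M₁.adjacent (∈-rights⁺ S x∈)
    avoids : ∀ {x y} → x ∈ S → y ∈ S → partner x ≢ y
    avoids {inj₁ _} {inj₁ _} x∈ y∈ e =
      M₀.avoids (∈-lefts⁺ S x∈) (∈-lefts⁺ S y∈) (inj₁-injective e)
    avoids {inj₂ _} {inj₂ _} x∈ y∈ e =
      M₁.avoids (∈-rights⁺ S x∈) (∈-rights⁺ S y∈) (inj₂-injective e)
    injectiveOn : ∀ {x y} → x ∈ S → y ∈ S → partner x ≡ partner y → x ≡ y
    injectiveOn {inj₁ _} {inj₁ _} x∈ y∈ e =
      cong inj₁ (M₀.injectiveOn (∈-lefts⁺ S x∈) (∈-lefts⁺ S y∈) (inj₁-injective e))
    injectiveOn {inj₂ _} {inj₂ _} x∈ y∈ e =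
      cong inj₂ (M₁.injectiveOn (∈-rights⁺ S x∈) (∈-rights⁺ S y∈) (inj₂-injective e))

module _ {V W : Set} {E : V → V → Set} {F : W → W → Set} (ι : E ≅G F) where
  open _≅G_ ι using (iso; preserve)
  open Bijection iso using (injective)
  open Inverse (⤖⇒↔ iso) using (to; from; strictlyInverseˡ; strictlyInverseʳ)

  ≅G-outMatching : ∀ {S} → OutMatching E (map from S) → OutMatching F S
  ≅G-outMatching {S} M = record
    { partner     = λ x → to (partner (from x))
    ; adjacent    = λ {x} x∈ → subst (λ z → F z (to (partner (from x))))
                                     (strictlyInverseˡ x) (preserve (adjacent (from∈ x∈)))
    ; avoids      = λ x∈ y∈ e →
                      avoids (from∈ x∈) (from∈ y∈) (trans (sym (strictlyInverseʳ _)) (cong from e))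
    ; injectiveOn = λ x∈ y∈ e →
                      from-injective iso (injectiveOn (from∈ x∈) (from∈ y∈) (injective e))
    }
    where
    open OutMatching M
    from∈ : ∀ {x} → x ∈ S → from x ∈ map from S
    from∈ = ∈-map⁺ from

xq-outMatching : ∀ {n V E} → XQ n V E → (S : List V) → length S ≤ n → OutMatching E S
xq-outMatching base S |S|≤1 = K₂-outMatching |S|≤1
xq-outMatching (rename G ι) S |S|≤n =
  ≅G-outMatching ι (xq-outMatching G _ (subst (_≤ _) (sym (length-map _ S)) |S|≤n))
xq-outMatching (sum G₀ G₁ φ) S |S|≤1+n with oneSided-or-sidesShorter S
... | inj₁ oneSided = across-outMatching φ oneSided
... | inj₂ (|L|<|S| , |R|<|S|) = ⊕-outMatching φ
  (xq-outMatching G₀ (lefts S) (s≤s⁻¹ (<-≤-trans |L|<|S| |S|≤1+n)))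
  (xq-outMatching G₁ (rights S) (s≤s⁻¹ (<-≤-trans |R|<|S| |S|≤1+n)))

lemma3p2 : (n : ℕ) → n ≥ 1 → {V : Set} → {E : V → V → Set} → XQ n V E
    → (k : ℕ) → k ≤ n → (u : Fin k → V) → Injective _≡_ _≡_ u
    → Σ (Fin k → V) (λ v → Injective _≡_ _≡_ v
        × (∀ i j → ¬ (v i ≡ u j))
        × (∀ i → E (u i) (v i)))
lemma3p2 n _ G k k≤n u u-injective =
  (λ i → partner (u i)) ,
  (λ {i} {j} e → u-injective (injectiveOn (u∈ i) (u∈ j) e)) ,
  (λ i j → avoids (u∈ i) (u∈ j)) ,
  (λ i → adjacent (u∈ i))
  where
  open OutMatching
    (xq-outMatching G (tabulate u) (subst (_≤ n) (sym (length-tabulate u)) k≤n))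
  u∈ : ∀ i → u i ∈ tabulate u
  u∈ = ∈-tabulate⁺
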